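{- For every $n\ge1$, $$\sum_{w\in\mathcal F_{n,2}}\mathrm{area}(P(w))=\sum_{i=0}^{\lfloor (n+1)/2\rfloor}\binom{n+1-i}{i}(n+i)=\frac{1}{5}\bigl(6nF_{n+2}+(n+2)F_n\bigr),$$ where $F_m$ is the $m$-th Fibonacci number ($F_0=0$, $F_1=1$, $F_m=F_{m-1}+F_{m-2}$).
   Context: $\mathcal F_{n,2}$ denotes the set of binary words $w=w_1\cdots w_n\in\{0,1\}^n$ with no two consecutive $1$'s. To $w$ one associates the bargraph polyomino $P(w)$ whose $i$-th column consists of $w_i+1$ unit cells; $\mathrm{area}(P)$ is the number of cells of $P$ (so $\mathrm{area}(P(w))=n+w_1+\dots+w_n$). -}

module Defs where

open import Data.Nat using (ℕ; zero; suc; _+_; _*_)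
open import Data.Bool using (Bool; true; false; if_then_else_)
open import Data.List using (List; []; _∷_; map; _++_; filter; upTo)
open import Data.Nat.ListAction using (sum)
open import Data.Vec using (Vec; []; _∷_; toList)
open import Relation.Nullary using (Dec; yes; no; ¬_)
open import Data.Empty using (⊥)
open import Data.Unit using (⊤; tt)
open import Data.Product using (_×_)

Word : ℕ → Set
Word n = Vec Bool n

allWords : (n : ℕ) → List (Word n)
allWords zero = [] ∷ []
allWords (suc n) = map (false ∷_) (allWords n) ++ map (true ∷_) (allWords n)

NoTwoConsecOnes : ∀ {n} → Word n → Set
NoTwoConsecOnes [] = ⊤
NoTwoConsecOnes (b ∷ []) = ⊤
NoTwoConsecOnes (true ∷ true ∷ w) = ⊥
NoTwoConsecOnes (_ ∷ b ∷ w) = NoTwoConsecOnes (b ∷ w)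

noTwoConsecOnes? : ∀ {n} (w : Word n) → Dec (NoTwoConsecOnes w)
noTwoConsecOnes? [] = yes tt
noTwoConsecOnes? (b ∷ []) = yes tt
noTwoConsecOnes? (true ∷ true ∷ w) = no (λ ())
noTwoConsecOnes? (true ∷ false ∷ w) = noTwoConsecOnes? (false ∷ w)
noTwoConsecOnes? (false ∷ b ∷ w) = noTwoConsecOnes? (b ∷ w)

-- F_{n,2}: the list (without repetition) of binary words of length n with no two consecutive 1's.
F : (n : ℕ) → List (Word n)
F n = filter noTwoConsecOnes? (allWords n)

bit : Bool → ℕ
bit true = 1
bit false = 0

bargraph : ∀ {n} → Word n → List ℕ
bargraph w = map (λ b → bit b + 1) (toList w)

area : List ℕ → ℕ
area cols = sum cols

fib : ℕ → ℕ
fib zero = 0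
fib (suc zero) = 1
fib (suc (suc m)) = fib (suc m) + fib m

sumTo : ℕ → (ℕ → ℕ) → ℕ
sumTo k f = sum (map f (upTo (suc k)))

{-# OPTIONS --safe #-}
-- A word of F_{n+2} is either 0 followed by a word of F_{n+1} or 10 followed by a word of
-- F_n, so |F_n| = fib (n + 2) and the total area A_n satisfies
-- A_{n+2} = (|F_{n+1}| + A_{n+1}) + (3 |F_n| + A_n).  By Pascal's rule the binomial sums
-- diagonal m g = Σᵢ C(m ∸ i, i) g(i) satisfy
-- diagonal (m + 2) g = diagonal (m + 1) g + diagonal m (g ∘ suc), and shifting g by a
-- constant c adds c · fib (m + 1); together these identify A_n with diagonal (n + 1) (n +_),
-- the middle expression.  The closed form then reduces to the Fibonacci identity
-- 5 · diagonal (n + 1) id = n fib (n + 2) + (n + 2) fib n, proved by induction.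
module Submission where

open import Defs
open import Data.Nat using (ℕ; zero; suc; _+_; _*_; _∸_; _≤_; _<_; _≥_; z≤n; s≤s)
open import Data.Nat.Properties
open import Data.Nat.DivMod using (_/_; m≡m%n+[m/n]*n; m%n<n)
open import Data.Nat.Combinatorics using (_C_; nCk+nC[k+1]≡[n+1]C[k+1])
open import Data.Nat.ListAction using (sum)
open import Data.Nat.ListAction.Properties using (sum-++)
open import Data.Nat.Solver using (module +-*-Solver)
open import Data.Bool using (true; false)
open import Data.List using (List; []; _∷_; _++_; map; filter; length; applyUpTo)
open import Data.List.Properties
  using (map-++; map-∘; length-++; length-map; map-applyUpTo; ++-identityʳ; filter-++; filter-≐)
open import Data.Vec using ([]; _∷_)
open import Data.Product using (_×_; _,_)
open import Data.Sum using (inj₁; inj₂)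
open import Function using (_∘_; id)
open import Relation.Nullary using (does)
open import Relation.Unary using (Decidable; _≐_)
open import Relation.Binary.PropositionalEquality
  using (_≡_; refl; sym; trans; cong; cong₂; subst; subst₂; module ≡-Reasoning)

open +-*-Solver using (solve; _:=_; con; _:+_; _:*_)
open ≡-Reasoning

filter-map : ∀ {A B : Set} {P : B → Set} (P? : Decidable P) (f : A → B) (xs : List A) →
  filter P? (map f xs) ≡ map f (filter (P? ∘ f) xs)
filter-map P? f [] = refl
filter-map P? f (x ∷ xs) with does (P? (f x))
... | true  = cong (f x ∷_) (filter-map P? f xs)
... | false = filter-map P? f xs

sum-map-c+f : ∀ {A : Set} c (f : A → ℕ) (xs : List A) →
  sum (map (λ x → c + f x) xs) ≡ c * length xs + sum (map f xs)
sum-map-c+f c f [] = sym (cong (_+ 0) (*-zeroʳ c))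
sum-map-c+f c f (x ∷ xs) = begin
  c + f x + sum (map (λ x → c + f x) xs)   ≡⟨ cong (c + f x +_) (sum-map-c+f c f xs) ⟩
  c + f x + (c * length xs + sum (map f xs)) ≡⟨ solve 4 (λ c y l s → c :+ y :+ (c :* l :+ s) := c :+ c :* l :+ (y :+ s))
                                                 refl c (f x) (length xs) (sum (map f xs)) ⟩
  c + c * length xs + (f x + sum (map f xs)) ≡⟨ cong (_+ (f x + sum (map f xs))) (sym (*-suc c (length xs))) ⟩
  c * suc (length xs) + sum (map f (x ∷ xs)) ∎

noTwoConsecOnes-false∷ : ∀ {n} (w : Word n) → NoTwoConsecOnes (false ∷ w) ≡ NoTwoConsecOnes w
noTwoConsecOnes-false∷ []      = refl
noTwoConsecOnes-false∷ (b ∷ w) = refl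

false∷-≐ : ∀ {n} → (λ (w : Word n) → NoTwoConsecOnes (false ∷ w)) ≐ NoTwoConsecOnes
false∷-≐ = (λ {w} → subst id (noTwoConsecOnes-false∷ w))
         , (λ {w} → subst id (sym (noTwoConsecOnes-false∷ w)))

filter-false∷ : ∀ {n} (ws : List (Word n)) →
  filter noTwoConsecOnes? (map (false ∷_) ws) ≡ map (false ∷_) (filter noTwoConsecOnes? ws)
filter-false∷ ws = trans (filter-map noTwoConsecOnes? (false ∷_) ws)
  (cong (map (false ∷_)) (filter-≐ _ noTwoConsecOnes? false∷-≐ ws))

filter-true∷false∷ : ∀ {n} (ws : List (Word n)) →
  filter noTwoConsecOnes? (map (λ w → true ∷ false ∷ w) ws)
    ≡ map (λ w → true ∷ false ∷ w) (filter noTwoConsecOnes? ws)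
filter-true∷false∷ ws = trans (filter-map noTwoConsecOnes? (λ w → true ∷ false ∷ w) ws)
  (cong (map (λ w → true ∷ false ∷ w)) (filter-≐ _ noTwoConsecOnes? false∷-≐ ws))

filter-true∷true∷ : ∀ {n} (ws : List (Word n)) →
  filter noTwoConsecOnes? (map (λ w → true ∷ true ∷ w) ws) ≡ []
filter-true∷true∷ []       = refl
filter-true∷true∷ (w ∷ ws) = filter-true∷true∷ ws

allWords-true∷ : ∀ n → map (true ∷_) (allWords (suc n))
  ≡ map (λ w → true ∷ false ∷ w) (allWords n) ++ map (λ w → true ∷ true ∷ w) (allWords n)
allWords-true∷ n = trans (map-++ (true ∷_) (map (false ∷_) (allWords n)) (map (true ∷_) (allWords n)))
  (cong₂ _++_ (sym (map-∘ (allWords n))) (sym (map-∘ (allWords n))))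

F-suc-suc : ∀ n → F (suc (suc n)) ≡ map (false ∷_) (F (suc n)) ++ map (λ w → true ∷ false ∷ w) (F n)
F-suc-suc n = begin
  valid (map (false ∷_) W₁ ++ map (true ∷_) W₁)
    ≡⟨ filter-++ noTwoConsecOnes? (map (false ∷_) W₁) (map (true ∷_) W₁) ⟩
  valid (map (false ∷_) W₁) ++ valid (map (true ∷_) W₁)
    ≡⟨ cong₂ _++_ (filter-false∷ W₁) (cong valid (allWords-true∷ n)) ⟩
  map (false ∷_) (F (suc n)) ++ valid (map true∷false∷ W₀ ++ map true∷true∷ W₀)
    ≡⟨ cong (map (false ∷_) (F (suc n)) ++_) (filter-++ noTwoConsecOnes? (map true∷false∷ W₀) (map true∷true∷ W₀)) ⟩
  map (false ∷_) (F (suc n)) ++ (valid (map true∷false∷ W₀) ++ valid (map true∷true∷ W₀))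
    ≡⟨ cong (map (false ∷_) (F (suc n)) ++_) (cong₂ _++_ (filter-true∷false∷ W₀) (filter-true∷true∷ W₀)) ⟩
  map (false ∷_) (F (suc n)) ++ (map true∷false∷ (F n) ++ [])
    ≡⟨ cong (map (false ∷_) (F (suc n)) ++_) (++-identityʳ (map true∷false∷ (F n))) ⟩
  map (false ∷_) (F (suc n)) ++ map true∷false∷ (F n) ∎
  where
  W₀ : List (Word n)
  W₀ = allWords n
  W₁ : List (Word (suc n))
  W₁ = allWords (suc n)
  valid : List (Word (suc (suc n))) → List (Word (suc (suc n)))
  valid = filter noTwoConsecOnes?
  true∷false∷ true∷true∷ : Word n → Word (suc (suc n))
  true∷false∷ w = true ∷ false ∷ w
  true∷true∷  w = true ∷ true ∷ w

length-F : ∀ n → length (F n) ≡ fib (suc (suc n))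
length-F zero          = refl
length-F (suc zero)    = refl
length-F (suc (suc n)) = begin
  length (F (suc (suc n)))
    ≡⟨ cong length (F-suc-suc n) ⟩
  length (map (false ∷_) (F (suc n)) ++ map (λ w → true ∷ false ∷ w) (F n))
    ≡⟨ length-++ (map (false ∷_) (F (suc n))) ⟩
  length (map (false ∷_) (F (suc n))) + length (map (λ w → true ∷ false ∷ w) (F n))
    ≡⟨ cong₂ _+_ (length-map _ (F (suc n))) (length-map _ (F n)) ⟩
  length (F (suc n)) + length (F n)
    ≡⟨ cong₂ _+_ (length-F (suc n)) (length-F n) ⟩
  fib (suc (suc (suc n))) + fib (suc (suc n)) ∎

areaSum : ℕ → ℕ
areaSum n = sum (map (λ w → area (bargraph w)) (F n))

areaSum-suc-suc : ∀ n → areaSum (suc (suc n))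
  ≡ (1 * length (F (suc n)) + areaSum (suc n)) + (3 * length (F n) + areaSum n)
areaSum-suc-suc n = begin
  sum (map cells (F (suc (suc n))))
    ≡⟨ cong (sum ∘ map cells) (F-suc-suc n) ⟩
  sum (map cells (map (false ∷_) F₁ ++ map true∷false∷ F₀))
    ≡⟨ cong sum (map-++ cells (map (false ∷_) F₁) (map true∷false∷ F₀)) ⟩
  sum (map cells (map (false ∷_) F₁) ++ map cells (map true∷false∷ F₀))
    ≡⟨ sum-++ (map cells (map (false ∷_) F₁)) (map cells (map true∷false∷ F₀)) ⟩
  sum (map cells (map (false ∷_) F₁)) + sum (map cells (map true∷false∷ F₀))
    ≡⟨ cong₂ _+_ (cong sum (sym (map-∘ F₁))) (cong sum (sym (map-∘ F₀))) ⟩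
  sum (map (λ w → 1 + cells w) F₁) + sum (map (λ w → 3 + cells w) F₀)
    ≡⟨ cong₂ _+_ (sum-map-c+f 1 cells F₁) (sum-map-c+f 3 cells F₀) ⟩
  (1 * length F₁ + areaSum (suc n)) + (3 * length F₀ + areaSum n) ∎
  where
  F₀ : List (Word n)
  F₀ = F n
  F₁ : List (Word (suc n))
  F₁ = F (suc n)
  true∷false∷ : Word n → Word (suc (suc n))
  true∷false∷ w = true ∷ false ∷ w
  cells : ∀ {m} → Word m → ℕ
  cells w = area (bargraph w)

diagonal : ℕ → (ℕ → ℕ) → ℕ
diagonal zero          g = g 0
diagonal (suc zero)    g = g 0
diagonal (suc (suc m)) g = diagonal (suc m) g + diagonal m (g ∘ suc)

diagonal-cong : ∀ m {f g : ℕ → ℕ} → (∀ i → f i ≡ g i) → diagonal m f ≡ diagonal m g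
diagonal-cong zero          f≗g = f≗g 0
diagonal-cong (suc zero)    f≗g = f≗g 0
diagonal-cong (suc (suc m)) f≗g = cong₂ _+_ (diagonal-cong (suc m) f≗g) (diagonal-cong m (f≗g ∘ suc))

diagonal-shift : ∀ m c (g : ℕ → ℕ) → diagonal m (λ i → c + g i) ≡ c * fib (suc m) + diagonal m g
diagonal-shift zero          c g = cong (_+ g 0) (sym (*-identityʳ c))
diagonal-shift (suc zero)    c g = cong (_+ g 0) (sym (*-identityʳ c))
diagonal-shift (suc (suc m)) c g = begin
  diagonal (suc m) (λ i → c + g i) + diagonal m (λ i → c + g (suc i))
    ≡⟨ cong₂ _+_ (diagonal-shift (suc m) c g) (diagonal-shift m c (g ∘ suc)) ⟩
  (c * fib (suc (suc m)) + diagonal (suc m) g) + (c * fib (suc m) + diagonal m (g ∘ suc))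
    ≡⟨ solve 5 (λ c a b x y → c :* a :+ x :+ (c :* b :+ y) := c :* (a :+ b) :+ (x :+ y))
         refl c (fib (suc (suc m))) (fib (suc m)) (diagonal (suc m) g) (diagonal m (g ∘ suc)) ⟩
  c * fib (suc (suc (suc m))) + diagonal (suc (suc m)) g ∎

areaSum-diagonal : ∀ n → areaSum n ≡ diagonal (suc n) (n +_)
areaSum-diagonal zero          = refl
areaSum-diagonal (suc zero)    = refl
areaSum-diagonal (suc (suc n)) = begin
  areaSum (suc (suc n))
    ≡⟨ areaSum-suc-suc n ⟩
  (1 * length (F (suc n)) + areaSum (suc n)) + (3 * length (F n) + areaSum n)
    ≡⟨ cong₂ _+_ (cong₂ (λ l a → 1 * l + a) (length-F (suc n)) (areaSum-diagonal (suc n)))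
                 (cong₂ (λ l a → 3 * l + a) (length-F n) (areaSum-diagonal n)) ⟩
  (1 * fib (suc (suc (suc n))) + diagonal (suc (suc n)) (suc n +_))
    + (3 * fib (suc (suc n)) + diagonal (suc n) (n +_))
    ≡⟨ cong₂ _+_ (sym (diagonal-shift (suc (suc n)) 1 (suc n +_))) (sym (diagonal-shift (suc n) 3 (n +_))) ⟩
  diagonal (suc (suc n)) (λ i → 1 + (suc n + i)) + diagonal (suc n) (λ i → 3 + (n + i))
    ≡⟨ cong (diagonal (suc (suc n)) (suc (suc n) +_) +_)
         (diagonal-cong (suc n) (λ i → cong (2 +_) (sym (+-suc n i)))) ⟩
  diagonal (suc (suc (suc n))) (suc (suc n) +_) ∎

sum-applyUpTo-cong : ∀ K {f g : ℕ → ℕ} → (∀ i → f i ≡ g i) → sum (applyUpTo f K) ≡ sum (applyUpTo g K)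
sum-applyUpTo-cong zero    f≗g = refl
sum-applyUpTo-cong (suc K) f≗g = cong₂ _+_ (f≗g 0) (sum-applyUpTo-cong K (f≗g ∘ suc))

sum-applyUpTo-zero : ∀ K {f : ℕ → ℕ} → (∀ i → f i ≡ 0) → sum (applyUpTo f K) ≡ 0
sum-applyUpTo-zero zero    f≗0 = refl
sum-applyUpTo-zero (suc K) f≗0 = cong₂ _+_ (f≗0 0) (sum-applyUpTo-zero K (f≗0 ∘ suc))

sum-applyUpTo-+ : ∀ K (f g : ℕ → ℕ) →
  sum (applyUpTo (λ i → f i + g i) K) ≡ sum (applyUpTo f K) + sum (applyUpTo g K)
sum-applyUpTo-+ zero    f g = refl
sum-applyUpTo-+ (suc K) f g = begin
  f 0 + g 0 + sum (applyUpTo (λ i → f (suc i) + g (suc i)) K)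
    ≡⟨ cong (f 0 + g 0 +_) (sum-applyUpTo-+ K (f ∘ suc) (g ∘ suc)) ⟩
  f 0 + g 0 + (sum (applyUpTo (f ∘ suc) K) + sum (applyUpTo (g ∘ suc) K))
    ≡⟨ solve 4 (λ a b x y → a :+ b :+ (x :+ y) := a :+ x :+ (b :+ y))
         refl (f 0) (g 0) (sum (applyUpTo (f ∘ suc) K)) (sum (applyUpTo (g ∘ suc) K)) ⟩
  sum (applyUpTo f (suc K)) + sum (applyUpTo g (suc K)) ∎

pascal-∸ : ∀ m i → (suc m ∸ i) C suc i ≡ (m ∸ i) C suc i + (m ∸ i) C i
pascal-∸ m i with ≤-<-connex i m
... | inj₁ i≤m = begin
  (suc m ∸ i) C suc i           ≡⟨ cong (_C suc i) (+-∸-assoc 1 i≤m) ⟩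
  suc (m ∸ i) C suc i           ≡⟨ nCk+nC[k+1]≡[n+1]C[k+1] (m ∸ i) i ⟨
  (m ∸ i) C i + (m ∸ i) C suc i ≡⟨ +-comm ((m ∸ i) C i) ((m ∸ i) C suc i) ⟩
  (m ∸ i) C suc i + (m ∸ i) C i ∎
... | inj₂ m<i rewrite m≤n⇒m∸n≡0 m<i | m≤n⇒m∸n≡0 (<⇒≤ m<i) = both-zero m<i
  where
  both-zero : ∀ {i} → m < i → 0 C suc i ≡ 0 C suc i + 0 C i
  both-zero {suc i} _ = refl

diagonalTerm : ℕ → (ℕ → ℕ) → ℕ → ℕ
diagonalTerm m g i = ((m ∸ i) C i) * g i

diagonalTerm-≤1 : ∀ {m} → m ≤ 1 → ∀ g i → diagonalTerm m g (suc i) ≡ 0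
diagonalTerm-≤1 z≤n       g i = refl
diagonalTerm-≤1 (s≤s z≤n) g i = cong (λ k → (k C suc i) * g (suc i)) (0∸n≡0 i)

sum-diagonalTerm-≤1 : ∀ {m} → m ≤ 1 → ∀ K g → sum (applyUpTo (diagonalTerm m g) (suc K)) ≡ g 0
sum-diagonalTerm-≤1 {m} m≤1 K g = begin
  (m C 0) * g 0 + sum (applyUpTo (diagonalTerm m g ∘ suc) K)
    ≡⟨ cong₂ _+_ (*-identityˡ (g 0)) (sum-applyUpTo-zero K (diagonalTerm-≤1 m≤1 g)) ⟩
  g 0 + 0
    ≡⟨ +-identityʳ (g 0) ⟩
  g 0 ∎

-- Terms with m < 2 i vanish, so any K with m < 2 K covers the whole diagonal.
sum-diagonalTerm : ∀ m K g → m < 2 * K → sum (applyUpTo (diagonalTerm m g) K) ≡ diagonal m g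
sum-diagonalTerm zero          (suc K) g _ = sum-diagonalTerm-≤1 z≤n K g
sum-diagonalTerm (suc zero)    (suc K) g _ = sum-diagonalTerm-≤1 (s≤s z≤n) K g
sum-diagonalTerm (suc (suc m)) (suc K) g m+2<2K+2 = begin
  t₂ 0 + sum (applyUpTo (t₂ ∘ suc) K)
    ≡⟨ cong (t₁ 0 +_) (sum-applyUpTo-cong K pascal-term) ⟩
  t₁ 0 + sum (applyUpTo (λ i → t₁ (suc i) + t₀ i) K)
    ≡⟨ cong (t₁ 0 +_) (sum-applyUpTo-+ K (t₁ ∘ suc) t₀) ⟩
  t₁ 0 + (sum (applyUpTo (t₁ ∘ suc) K) + sum (applyUpTo t₀ K))
    ≡⟨ +-assoc (t₁ 0) (sum (applyUpTo (t₁ ∘ suc) K)) (sum (applyUpTo t₀ K)) ⟨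
  sum (applyUpTo t₁ (suc K)) + sum (applyUpTo t₀ K)
    ≡⟨ cong₂ _+_ (sum-diagonalTerm (suc m) (suc K) g m+1<2K+2) (sum-diagonalTerm m K (g ∘ suc) m<2K) ⟩
  diagonal (suc (suc m)) g ∎
  where
  t₂ t₁ t₀ : ℕ → ℕ
  t₂ = diagonalTerm (suc (suc m)) g
  t₁ = diagonalTerm (suc m) g
  t₀ = diagonalTerm m (g ∘ suc)
  pascal-term : ∀ i → t₂ (suc i) ≡ t₁ (suc i) + t₀ i
  pascal-term i = trans (cong (_* g (suc i)) (pascal-∸ m i))
    (*-distribʳ-+ (g (suc i)) ((m ∸ i) C suc i) ((m ∸ i) C i))
  m+1<2K+2 : suc m < 2 * suc K
  m+1<2K+2 = <-trans (n<1+n (suc m)) m+2<2K+2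
  m<2K : m < 2 * K
  m<2K = ≤-pred (≤-pred (subst (suc (suc (suc m)) ≤_) (*-suc 2 K) m+2<2K+2))

diagonal-id-suc-suc : ∀ m → diagonal (suc (suc m)) id ≡ diagonal (suc m) id + (fib (suc m) + diagonal m id)
diagonal-id-suc-suc m = cong (diagonal (suc m) id +_)
  (trans (diagonal-shift m 1 id) (cong (_+ diagonal m id) (*-identityˡ (fib (suc m)))))

5*diagonal-id : ∀ n → 5 * diagonal (suc n) id ≡ n * fib (suc (suc n)) + suc (suc n) * fib n
5*diagonal-id zero          = refl
5*diagonal-id (suc zero)    = refl
5*diagonal-id (suc (suc n)) = begin
  5 * diagonal (suc (suc (suc n))) id
    ≡⟨ cong (5 *_) (diagonal-id-suc-suc (suc n)) ⟩
  5 * (diagonal (suc (suc n)) id + (fib (suc (suc n)) + diagonal (suc n) id))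
    ≡⟨ solve 3 (λ x y f → con 5 :* (x :+ (f :+ y)) := con 5 :* x :+ con 5 :* f :+ con 5 :* y)
         refl (diagonal (suc (suc n)) id) (diagonal (suc n) id) (fib (suc (suc n))) ⟩
  5 * diagonal (suc (suc n)) id + 5 * fib (suc (suc n)) + 5 * diagonal (suc n) id
    ≡⟨ cong₂ (λ x y → x + 5 * fib (suc (suc n)) + y) (5*diagonal-id (suc n)) (5*diagonal-id n) ⟩
  (suc n * fib (suc (suc (suc n))) + suc (suc (suc n)) * fib (suc n)) + 5 * fib (suc (suc n))
    + (n * fib (suc (suc n)) + suc (suc n) * fib n)
    ≡⟨ solve 3 (λ n a b → (con 1 :+ n) :* (b :+ a :+ b) :+ (con 3 :+ n) :* b :+ con 5 :* (b :+ a)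
                          :+ (n :* (b :+ a) :+ (con 2 :+ n) :* a)
                        := (con 2 :+ n) :* ((b :+ a :+ b) :+ (b :+ a)) :+ (con 4 :+ n) :* (b :+ a))
         refl n (fib n) (fib (suc n)) ⟩
  suc (suc n) * fib (suc (suc (suc (suc n)))) + suc (suc (suc (suc n))) * fib (suc (suc n)) ∎

5*diagonal-n+ : ∀ n → 5 * diagonal (suc n) (n +_) ≡ 6 * n * fib (n + 2) + (n + 2) * fib n
5*diagonal-n+ n = begin
  5 * diagonal (suc n) (n +_)
    ≡⟨ cong (5 *_) (diagonal-shift (suc n) n id) ⟩
  5 * (n * fib (suc (suc n)) + diagonal (suc n) id)
    ≡⟨ *-distribˡ-+ 5 (n * fib (suc (suc n))) (diagonal (suc n) id) ⟩
  5 * (n * fib (suc (suc n))) + 5 * diagonal (suc n) id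
    ≡⟨ cong (5 * (n * fib (suc (suc n))) +_) (5*diagonal-id n) ⟩
  5 * (n * fib (suc (suc n))) + (n * fib (suc (suc n)) + suc (suc n) * fib n)
    ≡⟨ solve 3 (λ n f g → con 5 :* (n :* f) :+ (n :* f :+ (con 2 :+ n) :* g) := con 6 :* n :* f :+ (con 2 :+ n) :* g)
         refl n (fib (suc (suc n))) (fib n) ⟩
  6 * n * fib (2 + n) + (2 + n) * fib n
    ≡⟨ cong₂ (λ k l → 6 * n * fib k + l * fib n) (+-comm 2 n) (+-comm 2 n) ⟩
  6 * n * fib (n + 2) + (n + 2) * fib n ∎

m<2*[1+m/2] : ∀ m → m < 2 * suc (m / 2)
m<2*[1+m/2] m = subst₂ _<_ (sym (m≡m%n+[m/n]*n m 2))
  (solve 1 (λ k → con 2 :+ k :* con 2 := con 2 :* (con 1 :+ k)) refl (m / 2))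
  (+-monoˡ-< (m / 2 * 2) (m%n<n m 2))

sumTo-diagonal : ∀ n →
  sumTo ((n + 1) / 2) (λ i → ((n + 1 ∸ i) C i) * (n + i)) ≡ diagonal (suc n) (n +_)
sumTo-diagonal n = begin
  sum (map (diagonalTerm (n + 1) (n +_)) (applyUpTo id (suc K)))
    ≡⟨ cong sum (map-applyUpTo id (diagonalTerm (n + 1) (n +_)) (suc K)) ⟩
  sum (applyUpTo (diagonalTerm (n + 1) (n +_)) (suc K))
    ≡⟨ sum-diagonalTerm (n + 1) (suc K) (n +_) (m<2*[1+m/2] (n + 1)) ⟩
  diagonal (n + 1) (n +_)
    ≡⟨ cong (λ m → diagonal m (n +_)) (+-comm n 1) ⟩
  diagonal (suc n) (n +_) ∎
  where K = (n + 1) / 2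

corollary1p4 : (n : ℕ) → n ≥ 1 →
    (sum (map (λ w → area (bargraph w)) (F n))
      ≡ sumTo ((n + 1) / 2) (λ i → ((n + 1 ∸ i) C i) * (n + i)))
    × (5 * sumTo ((n + 1) / 2) (λ i → ((n + 1 ∸ i) C i) * (n + i))
      ≡ 6 * n * fib (n + 2) + (n + 2) * fib n)
corollary1p4 n _ =
  trans (areaSum-diagonal n) (sym (sumTo-diagonal n)) ,
  trans (cong (5 *_) (sumTo-diagonal n)) (5*diagonal-n+ n)
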